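{- Let $R: t\to_{\tt ls} u$ be a useless redex and $Q: t\to r$ a useful redex of the same LSC term $t$ such that $R\prec_{LO}Q$. Then the unique residual $R'$ of $R$ after $Q$ is shallow and useless.
   Context: LSC terms: $t::= x\mid \lambda x.t\mid tu\mid t[x\leftarrow u]$ (explicit substitution binding $x$), modulo $\alpha$. Shallow contexts $C::=\langle\cdot\rangle\mid \lambda x.C\mid Ct\mid tC\mid C[x\leftarrow t]$; general contexts also allow $t[x\leftarrow C]$; a redex is shallow if its position is a shallow context. Substitution contexts $L::=\langle\cdot\rangle\mid L[x\leftarrow t]$; applicative contexts $A::=C\langle L\,t\rangle$. Rules: ${\tt dB}$: $(L\langle\lambda x.t\rangle)u\to L\langle t[x\leftarrow u]\rangle$; ${\tt ls}$: $C\langle x\rangle[x\leftarrow u]\to C\langle u\rangle[x\leftarrow u]$ ($C$ not capturing $x$); an ${\tt ls}$-step $D\langle C\langle x\rangle[x\leftarrow u]\rangle\to D\langle C\langle u\rangle[x\leftarrow u]\rangle$ is written compactly $E\langle x\rangle\to E\langle u\rangle$ with $E=D\langle C[x\leftarrow u]\rangle$, its position. A ${\tt dB}$-redex $C\langle L\langle\lambda x.t\rangle u\rangle$ has position $C$. Unfolding: $x\!\downarrow=x$, $(tu)\!\downarrow=t\!\downarrow u\!\downarrow$, $(\lambda x.t)\!\downarrow=\lambda x.t\!\downarrow$, $(t[x\leftarrow u])\!\downarrow=t\!\downarrow\{x\leftarrow u\!\downarrow\}$; relative unfolding $t\!\downarrow_{\langle\cdot\rangle}=t\!\downarrow$, $t\!\downarrow_{uC}=t\!\downarrow_{Cu}=t\!\downarrow_{\lambda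 x.C}=t\!\downarrow_C$, $t\!\downarrow_{C[x\leftarrow u]}=t\!\downarrow_C\{x\leftarrow u\!\downarrow\}$. A redex is useful if it is a ${\tt dB}$-redex, or an ${\tt ls}$-redex $C\langle x\rangle\to C\langle r\rangle$ (compact) such that $r\!\downarrow_C$ contains a $\beta$-redex, or $r\!\downarrow_C$ is an abstraction and $C$ is applicative; otherwise an ${\tt ls}$-redex is useless. $C\prec_p t$ means $t=C\langle u\rangle$. $\prec_O$: $\langle\cdot\rangle\prec_O C$ for $C\neq\langle\cdot\rangle$, closed under $E\langle\cdot\rangle$. $\prec_L$: if $C\prec_p t$, $D\prec_p u$ then $Cu\prec_L tD$ and $C[x\leftarrow u]\prec_L t[x\leftarrow D]$, closed under $E\langle\cdot\rangle$. $\prec_{LO}=\prec_O\cup\prec_L$, compared on positions. Residuals are those of the standard residual theory of the LSC. -}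

module Defs where

open import Data.Nat using (ℕ; zero; suc; _+_; _<ᵇ_; _≡ᵇ_; pred; _<_)
open import Data.Bool using (Bool; true; false; if_then_else_)
open import Data.List using (List; []; _∷_; _++_; length; map; replicate)
open import Data.List.Relation.Unary.All using (All)
open import Data.Product using (Σ; ∃; _×_; _,_)
open import Data.Sum using (_⊎_)
open import Data.Unit using (⊤)
open import Data.Empty using (⊥)
open import Relation.Nullary using (¬_)
open import Relation.Binary.PropositionalEquality using (_≡_; _≢_)

-- Terms (de Bruijn indices, so terms are automatically modulo α).
-- es t u  represents  t[x←u]  where x is index 0 in t.

data Tm : Set where
  var : ℕ → Tm
  lam : Tm → Tm
  app : Tm → Tm → Tm
  es  : Tm → Tm → Tm

sh : ℕ → ℕ → Tm → Tm
sh c k (var n)   = if n <ᵇ c then var n else var (n + k)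
sh c k (lam t)   = lam (sh (suc c) k t)
sh c k (app t u) = app (sh c k t) (sh c k u)
sh c k (es t u)  = es (sh (suc c) k t) (sh c k u)

-- subAt k s t : t{x_k ← s}, where s lives in the scope outside the k
-- binders enclosing index k; variables above k are decremented.
subAt : ℕ → Tm → Tm → Tm
subAt k s (var n)   =
  if n <ᵇ k then var n else (if n ≡ᵇ k then sh 0 k s else var (pred n))
subAt k s (lam t)   = lam (subAt (suc k) s t)
subAt k s (app t u) = app (subAt k s t) (subAt k s u)
subAt k s (es t u)  = es (subAt (suc k) s t) (subAt k s u)

unf : Tm → Tm
unf (var n)   = var n
unf (lam t)   = lam (unf t)
unf (app t u) = app (unf t) (unf u)
unf (es t u)  = subAt 0 (unf u) (unf t)

-- Contexts, as lists of one-layer frames, outermost frame first.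

data Frame : Set where
  lamF  : Frame
  appLF : Tm → Frame
  appRF : Tm → Frame
  esBF  : Tm → Frame
  esSF  : Tm → Frame

Ctx : Set
Ctx = List Frame

plugF : Frame → Tm → Tm
plugF lamF      s = lam s
plugF (appLF t) s = app s t
plugF (appRF t) s = app t s
plugF (esBF t)  s = es s t
plugF (esSF t)  s = es t s

-- C⟨s⟩ (plugging may capture, as intended)
plug : Ctx → Tm → Tm
plug []      s = s
plug (f ∷ C) s = plugF f (plug C s)

-- substitution contexts L, as list of the substituted terms, outermost first
plugL : List Tm → Tm → Tm
plugL []      s = s
plugL (v ∷ L) s = es (plugL L s) v

nb : Ctx → ℕ
nb []          = 0
nb (lamF ∷ C)  = suc (nb C)
nb (esBF _ ∷ C) = suc (nb C)
nb (_ ∷ C)     = nb C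

nλ : Ctx → ℕ
nλ []         = 0
nλ (lamF ∷ C) = suc (nλ C)
nλ (_ ∷ C)    = nλ C

data ShallowF : Frame → Set where
  lamS  : ShallowF lamF
  appLS : ∀ {t} → ShallowF (appLF t)
  appRS : ∀ {t} → ShallowF (appRF t)
  esBS  : ∀ {t} → ShallowF (esBF t)

Shallow : Ctx → Set
Shallow = All ShallowF

-- relative unfolding t↓_C (the clauses of the paper; it is only defined
-- on shallow contexts, the esSF clause is never used: see Useful/Useless)
relUnf : Ctx → Tm → Tm
relUnf []           t = unf t
relUnf (lamF ∷ C)   t = relUnf C t
relUnf (appLF _ ∷ C) t = relUnf C t
relUnf (appRF _ ∷ C) t = relUnf C t
relUnf (esBF u ∷ C) t = subAt (nλ C) (unf u) (relUnf C t)
relUnf (esSF _ ∷ C) t = relUnf C t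

Applicative : Ctx → Set
Applicative E = Σ Ctx λ C → Σ Tm λ t → Σ (List Tm) λ L →
  E ≡ C ++ (appLF t ∷ map esBF L)

data HasBeta : Tm → Set where
  here  : ∀ {s u} → HasBeta (app (lam s) u)
  inLam : ∀ {t} → HasBeta t → HasBeta (lam t)
  inAL  : ∀ {t u} → HasBeta t → HasBeta (app t u)
  inAR  : ∀ {t u} → HasBeta u → HasBeta (app t u)
  inEB  : ∀ {t u} → HasBeta t → HasBeta (es t u)
  inES  : ∀ {t u} → HasBeta u → HasBeta (es t u)

IsAbs : Tm → Set
IsAbs t = Σ Tm λ s → t ≡ lam s

data Redex (t : Tm) : Set where
  dB : (C : Ctx) (L : List Tm) (s u : Tm) →
       t ≡ plug C (app (plugL L (lam s)) u) → Redex t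
  -- D⟨C⟨x⟩[x←u]⟩, the occurrence x being bound by the displayed ES
  ls : (D C : Ctx) (u : Tm) →
       t ≡ plug D (es (plug C (var (nb C))) u) → Redex t

pos : ∀ {t} → Redex t → Ctx
pos (dB C _ _ _ _) = C
pos (ls D C u _)   = D ++ (esBF u ∷ C)

target : ∀ {t} → Redex t → Tm
target (dB C L s u _) = plug C (plugL L (es s (sh 0 (length L) u)))
target (ls D C u _)   = plug D (es (plug C (sh 0 (suc (nb C)) u)) u)

-- the term r of a compact ls-step E⟨x⟩ → E⟨r⟩, as it appears at the hole of E
-- (i.e. the substituted term shifted under the binders of E below the ES)
lsTerm : Ctx → Tm → Tm
lsTerm C u = sh 0 (suc (nb C)) u

UsefulCond : Ctx → Tm → Set
UsefulCond E r = HasBeta (relUnf E r) ⊎ (IsAbs (relUnf E r) × Applicative E)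

Useful : ∀ {t} → Redex t → Set
Useful (dB _ _ _ _ _) = ⊤
Useful (ls D C u _)   =
  Shallow (D ++ (esBF u ∷ C)) × UsefulCond (D ++ (esBF u ∷ C)) (lsTerm C u)

Useless : ∀ {t} → Redex t → Set
Useless (dB _ _ _ _ _) = ⊥
Useless (ls D C u _)   =
  Shallow (D ++ (esBF u ∷ C)) × ¬ UsefulCond (D ++ (esBF u ∷ C)) (lsTerm C u)

ShallowRedex : ∀ {t} → Redex t → Set
ShallowRedex R = Shallow (pos R)

_≺p_ : Ctx → Tm → Set
C ≺p t = Σ Tm λ s → t ≡ plug C s

data _≺O_ : Ctx → Ctx → Set where
  base : ∀ {f F} → [] ≺O (f ∷ F)
  step : ∀ {f C D} → C ≺O D → (f ∷ C) ≺O (f ∷ D)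

data _≺L_ : Ctx → Ctx → Set where
  baseApp : ∀ {C D t u} → C ≺p t → D ≺p u → (appLF u ∷ C) ≺L (appRF t ∷ D)
  baseES  : ∀ {C D t u} → C ≺p t → D ≺p u → (esBF u ∷ C) ≺L (esSF t ∷ D)
  step    : ∀ {f C D} → C ≺L D → (f ∷ C) ≺L (f ∷ D)

_≺LO_ : Ctx → Ctx → Set
C ≺LO D = C ≺O D ⊎ C ≺L D

-- Residuals (standard residual theory of the LSC, for one step),
-- described on the shapes (paths) of positions.

data Dir : Set where
  dλ dAL dAR dEB dES : Dir

Path : Set
Path = List Dir

dirF : Frame → Dir
dirF lamF      = dλ
dirF (appLF _) = dAL
dirF (appRF _) = dAR
dirF (esBF _)  = dEB
dirF (esSF _)  = dES

shape : Ctx → Path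
shape = map dirF

Prefix : Path → Path → Set
Prefix c p = Σ Path λ r → p ≡ c ++ r

data ResDB (c : Path) (n : ℕ) : Path → Path → Set where
  outside : ∀ {p} → ¬ Prefix c p → ResDB c n p p
  arg     : ∀ {p} →
            ResDB c n (c ++ dAR ∷ p) (c ++ replicate n dEB ++ dES ∷ p)
  subL    : ∀ {k p} → k < n →
            ResDB c n (c ++ dAL ∷ replicate k dEB ++ dES ∷ p)
                      (c ++ replicate k dEB ++ dES ∷ p)
  body    : ∀ {p} →
            ResDB c n (c ++ dAL ∷ replicate n dEB ++ dλ ∷ p)
                      (c ++ replicate n dEB ++ dEB ∷ p)

data ResLS (d e : Path) : Path → Path → Set where
  keep : ∀ {p} → p ≢ d ++ dEB ∷ e → ResLS d e p p
  copy : ∀ {p} → ResLS d e (d ++ dES ∷ p) (d ++ dEB ∷ e ++ p)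

ResPath : ∀ {t} → Redex t → Path → Path → Set
ResPath (dB C L _ _ _) = ResDB (shape C) (length L)
ResPath (ls D C _ _)   = ResLS (shape D) (shape C)

data Kind : Set where
  kdB kls : Kind

kind : ∀ {t} → Redex t → Kind
kind (dB _ _ _ _ _) = kdB
kind (ls _ _ _ _)   = kls

Residual : ∀ {t} (Q R : Redex t) → Redex (target Q) → Set
Residual Q R R' = kind R' ≡ kind R × ResPath Q (shape (pos R)) (shape (pos R'))

-- Under ≺LO the useless ls-redex R cannot lie above Q (the hole of its position
-- holds a variable), so the two positions diverge: at an application, R in the
-- function and Q in the argument, or at an explicit substitution, R in the body
-- and Q, necessarily a dB-redex since useful ls-redexes are shallow, in the
-- substituted term. Contracting Q only rewrites one frame on the path to R, so R
-- has exactly one residual, at a position of the same shape, hence shallow.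
-- It stays useless because relative unfolding ignores application arguments,
-- and because a β-normal unfolding must erase a substituted term containing a
-- dB-redex (whose unfolding always contains a β-redex), so the contraction
-- inside that term is invisible in the unfolding.
module Submission where

open import Defs
open import Data.Product using (Σ; _×_; _,_; proj₁)
open import Relation.Binary.PropositionalEquality
  using (_≡_; refl; sym; trans; cong; cong₂; subst; module ≡-Reasoning)
open import Data.Nat using (suc; _+_; _<ᵇ_; _≡ᵇ_)
open import Data.Nat.Properties using (+-identityʳ)
open import Data.Bool using (true; false)
open import Data.List using (List; []; _∷_; _++_; map; length)
open import Data.List.Properties using (++-assoc; ++-identityʳ; ++-cancelˡ; map-++; ∷-injective; ∷-injectiveˡ)
open import Data.List.Relation.Unary.All.Properties using (++⁻ʳ; map⁺; All¬⇒¬Any)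
open import Data.List.Relation.Unary.All as All using ([]; _∷_)
open import Data.List.Relation.Binary.Pointwise as Pointwise using (Pointwise; []; _∷_; ++⁺; All-resp-Pointwise)
open import Data.List.Membership.Propositional using (_∉_)
open import Data.List.Membership.Propositional.Properties using (∈-++⁺ʳ)
open import Data.List.Relation.Unary.Any using (here)
open import Data.Sum using (inj₁; inj₂)
open import Data.Empty using (⊥; ⊥-elim)
open import Relation.Nullary using (¬_)

plug-++ : ∀ A B s → plug (A ++ B) s ≡ plug A (plug B s)
plug-++ []      B s = refl
plug-++ (f ∷ A) B s = cong (plugF f) (plug-++ A B s)

-- frameAt and childAt invert plugF once the direction is known (junk values elsewhere).
frameAt : Dir → Tm → Frame
frameAt dλ  _         = lamF
frameAt dAL (app _ u) = appLF u
frameAt dAR (app t _) = appRF t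
frameAt dEB (es _ u)  = esBF u
frameAt dES (es t _)  = esSF t
frameAt _   _         = lamF

childAt : Dir → Tm → Tm
childAt dλ  (lam t)   = t
childAt dAL (app t _) = t
childAt dAR (app _ u) = u
childAt dEB (es t _)  = t
childAt dES (es _ u)  = u
childAt _   t         = t

frameAt-plugF : ∀ f s → frameAt (dirF f) (plugF f s) ≡ f
frameAt-plugF lamF      s = refl
frameAt-plugF (appLF _) s = refl
frameAt-plugF (appRF _) s = refl
frameAt-plugF (esBF _)  s = refl
frameAt-plugF (esSF _)  s = refl

childAt-plugF : ∀ f s → childAt (dirF f) (plugF f s) ≡ s
childAt-plugF lamF      s = refl
childAt-plugF (appLF _) s = refl
childAt-plugF (appRF _) s = refl
childAt-plugF (esBF _)  s = refl
childAt-plugF (esSF _)  s = refl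

plugF-injective : ∀ f {s s'} → plugF f s ≡ plugF f s' → s ≡ s'
plugF-injective f {s} {s'} e =
  trans (sym (childAt-plugF f s)) (trans (cong (childAt (dirF f)) e) (childAt-plugF f s'))

plugF-frame-injective : ∀ f f' {s s'} → dirF f ≡ dirF f' → plugF f s ≡ plugF f' s' → f ≡ f'
plugF-frame-injective f f' {s} {s'} d e =
  trans (sym (frameAt-plugF f s)) (trans (cong₂ frameAt d e) (frameAt-plugF f' s'))

plug-injective : ∀ P {s s'} → plug P s ≡ plug P s' → s ≡ s'
plug-injective []      e = e
plug-injective (f ∷ P) e = plug-injective P (plugF-injective f e)

plug-shape-injective : ∀ E E' {s s'} → plug E s ≡ plug E' s' → shape E ≡ shape E' → E ≡ E'
plug-shape-injective []      []        _ _ = refl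
plug-shape-injective (f ∷ E) (f' ∷ E') e d with ∷-injective d
... | d₀ , d₁ with plugF-frame-injective f f' d₀ e
... | refl = cong (f ∷_) (plug-shape-injective E E' (plugF-injective f e) d₁)

var≢plugF : ∀ f {n s} → var n ≡ plugF f s → ⊥
var≢plugF lamF      ()
var≢plugF (appLF _) ()
var≢plugF (appRF _) ()
var≢plugF (esBF _)  ()
var≢plugF (esSF _)  ()

dBRedex : List Tm → Tm → Tm → Tm
dBRedex L s u = app (plugL L (lam s)) u

redexTerm : ∀ {t} → Redex t → Tm
redexTerm (dB C L s u _) = dBRedex L s u
redexTerm (ls D C u _)   = var (nb C)

contractum : ∀ {t} → Redex t → Tm
contractum (dB C L s u _) = plugL L (es s (sh 0 (length L) u))
contractum (ls D C u _)   = lsTerm C u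

source-at : ∀ {t} (Q : Redex t) {P X} → pos Q ≡ P ++ X → t ≡ plug P (plug X (redexTerm Q))
source-at (dB C L s u e) {P} {X} refl = trans e (plug-++ P X _)
source-at (ls D C u e)   {P} {X} eq =
  trans e (trans (sym (plug-++ D (esBF u ∷ C) _)) (trans (cong (λ E → plug E _) eq) (plug-++ P X _)))

source-pos : ∀ {t} (Q : Redex t) → t ≡ plug (pos Q) (redexTerm Q)
source-pos Q = source-at Q {pos Q} {[]} (sym (++-identityʳ (pos Q)))

target-at : ∀ {t} (Q : Redex t) {P X} → pos Q ≡ P ++ X → target Q ≡ plug P (plug X (contractum Q))
target-at (dB C L s u e) {P} {X} refl = plug-++ P X _
target-at (ls D C u e)   {P} {X} eq =
  trans (sym (plug-++ D (esBF u ∷ C) _)) (trans (cong (λ E → plug E _) eq) (plug-++ P X _))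

UselessAt : Ctx → Tm → Set
UselessAt E r = Shallow E × ¬ UsefulCond E r

useless-shallow : ∀ {t} (R : Redex t) → Useless R → ShallowRedex R
useless-shallow (ls D C u _) (shallow , _) = shallow

shallow-∌esSF : ∀ P {b G} → ¬ Shallow (P ++ esSF b ∷ G)
shallow-∌esSF P shallow with ++⁻ʳ P shallow
... | () ∷ _

shallowF⇒dir≢dES : ∀ {f} → ShallowF f → dES ≡ dirF f → ⊥
shallowF⇒dir≢dES lamS  ()
shallowF⇒dir≢dES appLS ()
shallowF⇒dir≢dES appRS ()
shallowF⇒dir≢dES esBS  ()

shallow-shape-∌dES : ∀ {E} → Shallow E → dES ∉ shape E
shallow-shape-∌dES shallow = All¬⇒¬Any (map⁺ (All.map shallowF⇒dir≢dES shallow))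

≺O-extends : ∀ {C D} → C ≺O D → Σ Frame λ f → Σ Ctx λ F → D ≡ C ++ f ∷ F
≺O-extends base = _ , _ , refl
≺O-extends (step o) with ≺O-extends o
... | f , F , refl = f , F , refl

data Divergent : Frame → Frame → Set where
  divApp : ∀ {a b} → Divergent (appLF a) (appRF b)
  divES  : ∀ {a b} → Divergent (esBF a) (esSF b)

divergent-dir : ∀ {f g} → Divergent f g → dirF f ≡ dirF g → ⊥
divergent-dir divApp ()
divergent-dir divES  ()

≺L-divergence : ∀ {C D} → C ≺L D →
  Σ Ctx λ P → Σ Frame λ f → Σ Frame λ g → Σ Ctx λ F → Σ Ctx λ G →
    Divergent f g × C ≡ P ++ f ∷ F × D ≡ P ++ g ∷ G
≺L-divergence (baseApp _ _) = [] , _ , _ , _ , _ , divApp , refl , refl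
≺L-divergence (baseES _ _)  = [] , _ , _ , _ , _ , divES , refl , refl
≺L-divergence (step l) with ≺L-divergence l
... | P , f , g , F , G , div , refl , refl = _ ∷ P , f , g , F , G , div , refl , refl

divergent-¬prefix : ∀ P {f g} F G {E E'} → Divergent f g → E ≡ P ++ f ∷ F → E' ≡ P ++ g ∷ G →
  ¬ Prefix (shape E') (shape E)
divergent-¬prefix P {f} {g} F G div refl refl (r , e) =
  divergent-dir div (∷-injectiveˡ (++-cancelˡ (shape P) _ _ e'))
  where
  open ≡-Reasoning
  e' : shape P ++ dirF f ∷ shape F ≡ shape P ++ dirF g ∷ shape G ++ r
  e' = begin
    shape P ++ dirF f ∷ shape F        ≡⟨ sym (map-++ dirF P (f ∷ F)) ⟩
    shape (P ++ f ∷ F)                 ≡⟨ e ⟩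
    shape (P ++ g ∷ G) ++ r            ≡⟨ cong (_++ r) (map-++ dirF P (g ∷ G)) ⟩
    (shape P ++ dirF g ∷ shape G) ++ r ≡⟨ ++-assoc (shape P) _ r ⟩
    shape P ++ dirF g ∷ shape G ++ r   ∎

ls-¬≺O : ∀ {t} D C u (e : t ≡ plug D (es (plug C (var (nb C))) u)) (Q : Redex t) →
  ¬ pos (ls D C u e) ≺O pos Q
ls-¬≺O D C u e Q R≺Q with ≺O-extends R≺Q
... | f , F , posQ =
  var≢plugF f (plug-injective (D ++ esBF u ∷ C)
    (trans (sym (source-pos (ls D C u e))) (source-at Q {X = f ∷ F} posQ)))

resPath-disjoint : ∀ {t} (Q : Redex t) {p} → ¬ Prefix (shape (pos Q)) p → ResPath Q p p
resPath-disjoint (dB C L s u e) np = outside np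
resPath-disjoint (ls D C u e)   np =
  keep λ eq → np ([] , trans eq (trans (sym (map-++ dirF D (esBF u ∷ C))) (sym (++-identityʳ _))))

resPath-disjoint-unique : ∀ {t} (Q : Redex t) {p q} → ResPath Q p q →
  ¬ Prefix (shape (pos Q)) p → dES ∉ p → q ≡ p
resPath-disjoint-unique (dB C L s u e) (outside _) _  _ = refl
resPath-disjoint-unique (dB C L s u e) arg         np _ = ⊥-elim (np (_ , refl))
resPath-disjoint-unique (dB C L s u e) (subL _)    np _ = ⊥-elim (np (_ , refl))
resPath-disjoint-unique (dB C L s u e) body        np _ = ⊥-elim (np (_ , refl))
resPath-disjoint-unique (ls D C u e)   (keep _)    _  _ = refl
resPath-disjoint-unique (ls D C u e)   copy        _  noES = ⊥-elim (noES (∈-++⁺ʳ (shape D) (here refl)))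

disjoint-residual : ∀ {t} (Q R : Redex t) (R' : Redex (target Q)) →
  ¬ Prefix (shape (pos Q)) (shape (pos R)) → kind R' ≡ kind R → shape (pos R') ≡ shape (pos R) →
  Residual Q R R'
disjoint-residual Q R R' np sameKind sameShape =
  sameKind , subst (ResPath Q (shape (pos R))) (sym sameShape) (resPath-disjoint Q np)

disjoint-residual-unique : ∀ {t} (Q R : Redex t) (R' : Redex (target Q)) →
  ¬ Prefix (shape (pos Q)) (shape (pos R)) → ShallowRedex R → shape (pos R') ≡ shape (pos R) →
  ∀ R'' → Residual Q R R'' → pos R'' ≡ pos R'
disjoint-residual-unique Q R R' np shallow sameShape R'' (_ , resPath) =
  plug-shape-injective (pos R'') (pos R') (trans (sym (source-pos R'')) (source-pos R'))
    (trans (resPath-disjoint-unique Q resPath np (shallow-shape-∌dES shallow)) (sym sameShape))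

βNormal : Tm → Set
βNormal t = ¬ HasBeta t

hasBeta-sh : ∀ {c k t} → HasBeta t → HasBeta (sh c k t)
hasBeta-sh here      = here
hasBeta-sh (inLam h) = inLam (hasBeta-sh h)
hasBeta-sh (inAL h)  = inAL (hasBeta-sh h)
hasBeta-sh (inAR h)  = inAR (hasBeta-sh h)
hasBeta-sh (inEB h)  = inEB (hasBeta-sh h)
hasBeta-sh (inES h)  = inES (hasBeta-sh h)

hasBeta-subAt : ∀ {k s t} → HasBeta t → HasBeta (subAt k s t)
hasBeta-subAt here      = here
hasBeta-subAt (inLam h) = inLam (hasBeta-subAt h)
hasBeta-subAt (inAL h)  = inAL (hasBeta-subAt h)
hasBeta-subAt (inAR h)  = inAR (hasBeta-subAt h)
hasBeta-subAt (inEB h)  = inEB (hasBeta-subAt h)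
hasBeta-subAt (inES h)  = inES (hasBeta-subAt h)

-- s need only be replaceable when β-normal: if it occurs in the β-normal result, it is β-normal itself.
subAt-cong-βNormal : ∀ k t {s s'} → (βNormal s → s' ≡ s) → βNormal (subAt k s t) →
  subAt k s' t ≡ subAt k s t
subAt-cong-βNormal k (var n) eq nf with n <ᵇ k
... | true  = refl
... | false with n ≡ᵇ k
...   | true  = cong (sh 0 k) (eq λ h → nf (hasBeta-sh h))
...   | false = refl
subAt-cong-βNormal k (lam t)   eq nf = cong lam (subAt-cong-βNormal (suc k) t eq (λ h → nf (inLam h)))
subAt-cong-βNormal k (app t u) eq nf =
  cong₂ app (subAt-cong-βNormal k t eq (λ h → nf (inAL h))) (subAt-cong-βNormal k u eq (λ h → nf (inAR h)))
subAt-cong-βNormal k (es t u)  eq nf =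
  cong₂ es (subAt-cong-βNormal (suc k) t eq (λ h → nf (inEB h))) (subAt-cong-βNormal k u eq (λ h → nf (inES h)))

sh-identity : ∀ c t → sh c 0 t ≡ t
sh-identity c (var n) with n <ᵇ c
... | true  = refl
... | false = cong var (+-identityʳ n)
sh-identity c (lam t)   = cong lam (sh-identity (suc c) t)
sh-identity c (app t u) = cong₂ app (sh-identity c t) (sh-identity c u)
sh-identity c (es t u)  = cong₂ es (sh-identity (suc c) t) (sh-identity c u)

BetaUnderShifts : Tm → Set
BetaUnderShifts Y = ∀ c k → HasBeta (unf (sh c k Y))

unf-sh-plugL-abs : ∀ L c k s → IsAbs (unf (sh c k (plugL L (lam s))))
unf-sh-plugL-abs []      c k s = _ , refl
unf-sh-plugL-abs (v ∷ L) c k s with unf-sh-plugL-abs L (suc c) k s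
... | _ , e rewrite e = _ , refl

dB-betaUnderShifts : ∀ L s w → BetaUnderShifts (dBRedex L s w)
dB-betaUnderShifts L s w c k with unf-sh-plugL-abs L c k s
... | _ , e rewrite e = here

unf-sh-plug-erased : ∀ G {Y} X → BetaUnderShifts Y → ∀ c k →
  βNormal (unf (sh c k (plug G Y))) → unf (sh c k (plug G X)) ≡ unf (sh c k (plug G Y))
unf-sh-plug-erased []             X βY c k nf = ⊥-elim (nf (βY c k))
unf-sh-plug-erased (lamF ∷ G)     X βY c k nf =
  cong lam (unf-sh-plug-erased G X βY (suc c) k (λ h → nf (inLam h)))
unf-sh-plug-erased (appLF w ∷ G)  X βY c k nf =
  cong (λ z → app z (unf (sh c k w))) (unf-sh-plug-erased G X βY c k (λ h → nf (inAL h)))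
unf-sh-plug-erased (appRF w ∷ G)  X βY c k nf =
  cong (app (unf (sh c k w))) (unf-sh-plug-erased G X βY c k (λ h → nf (inAR h)))
unf-sh-plug-erased (esBF w ∷ G)   X βY c k nf =
  cong (subAt 0 (unf (sh c k w))) (unf-sh-plug-erased G X βY (suc c) k (λ h → nf (hasBeta-subAt h)))
unf-sh-plug-erased (esSF w ∷ G)   X βY c k nf =
  subAt-cong-βNormal 0 (unf (sh (suc c) k w)) (unf-sh-plug-erased G X βY c k) nf

unf-plug-erased : ∀ G {Y} X → BetaUnderShifts Y → βNormal (unf (plug G Y)) → unf (plug G X) ≡ unf (plug G Y)
unf-plug-erased G {Y} X βY nf = begin
  unf (plug G X)          ≡⟨ cong unf (sym (sh-identity 0 (plug G X))) ⟩
  unf (sh 0 0 (plug G X)) ≡⟨ unf-sh-plug-erased G X βY 0 0 nf₀ ⟩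
  unf (sh 0 0 (plug G Y)) ≡⟨ cong unf (sh-identity 0 (plug G Y)) ⟩
  unf (plug G Y)          ∎
  where
  open ≡-Reasoning
  nf₀ : βNormal (unf (sh 0 0 (plug G Y)))
  nf₀ = subst (λ z → βNormal (unf z)) (sym (sh-identity 0 (plug G Y))) nf

hasBeta-relUnf-++ : ∀ P X {r} → HasBeta (relUnf X r) → HasBeta (relUnf (P ++ X) r)
hasBeta-relUnf-++ []            X h = h
hasBeta-relUnf-++ (lamF ∷ P)    X h = hasBeta-relUnf-++ P X h
hasBeta-relUnf-++ (appLF _ ∷ P) X h = hasBeta-relUnf-++ P X h
hasBeta-relUnf-++ (appRF _ ∷ P) X h = hasBeta-relUnf-++ P X h
hasBeta-relUnf-++ (esBF _ ∷ P)  X h = hasBeta-subAt (hasBeta-relUnf-++ P X h)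
hasBeta-relUnf-++ (esSF _ ∷ P)  X h = hasBeta-relUnf-++ P X h

hasBeta-relUnf : ∀ C {r} → HasBeta (unf r) → HasBeta (relUnf C r)
hasBeta-relUnf C {r} h = subst (λ E → HasBeta (relUnf E r)) (++-identityʳ C) (hasBeta-relUnf-++ C [] h)

relUnf-cong-unf : ∀ C {r r'} → unf r ≡ unf r' → relUnf C r ≡ relUnf C r'
relUnf-cong-unf []            e = e
relUnf-cong-unf (lamF ∷ C)    e = relUnf-cong-unf C e
relUnf-cong-unf (appLF _ ∷ C) e = relUnf-cong-unf C e
relUnf-cong-unf (appRF _ ∷ C) e = relUnf-cong-unf C e
relUnf-cong-unf (esBF u ∷ C)  e = cong (subAt (nλ C) (unf u)) (relUnf-cong-unf C e)
relUnf-cong-unf (esSF _ ∷ C)  e = relUnf-cong-unf C e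

nλ-++ : ∀ P X → nλ (P ++ X) ≡ nλ P + nλ X
nλ-++ []            X = refl
nλ-++ (lamF ∷ P)    X = cong suc (nλ-++ P X)
nλ-++ (appLF _ ∷ P) X = nλ-++ P X
nλ-++ (appRF _ ∷ P) X = nλ-++ P X
nλ-++ (esBF _ ∷ P)  X = nλ-++ P X
nλ-++ (esSF _ ∷ P)  X = nλ-++ P X

relUnf-++-cong : ∀ P {X Y r r'} → nλ X ≡ nλ Y → relUnf X r ≡ relUnf Y r' →
  relUnf (P ++ X) r ≡ relUnf (P ++ Y) r'
relUnf-++-cong []            n e = e
relUnf-++-cong (lamF ∷ P)    n e = relUnf-++-cong P n e
relUnf-++-cong (appLF _ ∷ P) n e = relUnf-++-cong P n e
relUnf-++-cong (appRF _ ∷ P) n e = relUnf-++-cong P n e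
relUnf-++-cong (esSF _ ∷ P)  n e = relUnf-++-cong P n e
relUnf-++-cong (esBF u ∷ P) {X} {Y} n e = cong₂ (λ k z → subAt k (unf u) z) nλ-eq (relUnf-++-cong P n e)
  where
  nλ-eq : nλ (P ++ X) ≡ nλ (P ++ Y)
  nλ-eq = trans (nλ-++ P X) (trans (cong (nλ P +_) n) (sym (nλ-++ P Y)))

data FrameStep : Frame → Frame → Set where
  appArg  : ∀ {a a'} → FrameStep (appLF a) (appLF a')
  -- only the dB-redex being replaced matters, not what replaces it
  esRedex : ∀ G L s w X → FrameStep (esBF (plug G (dBRedex L s w))) (esBF (plug G X))

relUnf-esRedex : ∀ P F G {L s w} X {r r'} → relUnf F r' ≡ relUnf F r →
  βNormal (relUnf (P ++ esBF (plug G (dBRedex L s w)) ∷ F) r) →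
  relUnf (P ++ esBF (plug G X) ∷ F) r' ≡ relUnf (P ++ esBF (plug G (dBRedex L s w)) ∷ F) r
relUnf-esRedex P F G {L} {s} {w} X {r} {r'} e nf = relUnf-++-cong P refl (begin
  subAt (nλ F) (unf (plug G X)) (relUnf F r') ≡⟨ cong (subAt (nλ F) (unf (plug G X))) e ⟩
  subAt (nλ F) (unf (plug G X)) (relUnf F r)  ≡⟨ subAt-cong-βNormal (nλ F) (relUnf F r) erased nf′ ⟩
  subAt (nλ F) (unf u) (relUnf F r)           ∎)
  where
  open ≡-Reasoning
  u = plug G (dBRedex L s w)
  erased : βNormal (unf u) → unf (plug G X) ≡ unf u
  erased = unf-plug-erased G X (dB-betaUnderShifts L s w)
  nf′ : βNormal (subAt (nλ F) (unf u) (relUnf F r))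
  nf′ h = nf (hasBeta-relUnf-++ P (esBF u ∷ F) h)

relUnf-frameStep : ∀ P F {f f' r} → FrameStep f f' → βNormal (relUnf (P ++ f ∷ F) r) →
  relUnf (P ++ f' ∷ F) r ≡ relUnf (P ++ f ∷ F) r
relUnf-frameStep P F appArg              _  = relUnf-++-cong P refl refl
relUnf-frameStep P F (esRedex G L s w X) nf = relUnf-esRedex P F G X refl nf

relUnf-esRedex-lsTerm : ∀ P F G {L s w} X →
  βNormal (relUnf (P ++ esBF (plug G (dBRedex L s w)) ∷ F) (lsTerm F (plug G (dBRedex L s w)))) →
  relUnf (P ++ esBF (plug G X) ∷ F) (lsTerm F (plug G X)) ≡
  relUnf (P ++ esBF (plug G (dBRedex L s w)) ∷ F) (lsTerm F (plug G (dBRedex L s w)))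
relUnf-esRedex-lsTerm P F G {L} {s} {w} X nf = relUnf-esRedex P F G X (relUnf-cong-unf F erased) nf
  where
  erased = unf-sh-plug-erased G X (dB-betaUnderShifts L s w) 0 (suc (nb F))
             (λ h → nf (hasBeta-relUnf (P ++ esBF (plug G (dBRedex L s w)) ∷ F) h))

data SameKind : Frame → Frame → Set where
  lamK  : SameKind lamF lamF
  appLK : ∀ {a b} → SameKind (appLF a) (appLF b)
  appRK : ∀ {a b} → SameKind (appRF a) (appRF b)
  esBK  : ∀ {a b} → SameKind (esBF a) (esBF b)
  esSK  : ∀ {a b} → SameKind (esSF a) (esSF b)

sameKind-refl : ∀ {f} → SameKind f f
sameKind-refl {lamF}    = lamK
sameKind-refl {appLF _} = appLK
sameKind-refl {appRF _} = appRK
sameKind-refl {esBF _}  = esBK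
sameKind-refl {esSF _}  = esSK

sameKind-dir : ∀ {f f'} → SameKind f f' → dirF f ≡ dirF f'
sameKind-dir lamK  = refl
sameKind-dir appLK = refl
sameKind-dir appRK = refl
sameKind-dir esBK  = refl
sameKind-dir esSK  = refl

sameKind-shallowF : ∀ {f f'} → SameKind f f' → ShallowF f → ShallowF f'
sameKind-shallowF lamK  _ = lamS
sameKind-shallowF appLK _ = appLS
sameKind-shallowF appRK _ = appRS
sameKind-shallowF esBK  _ = esBS
sameKind-shallowF esSK  ()

frameStep-sameKind : ∀ {f f'} → FrameStep f f' → SameKind f f'
frameStep-sameKind appArg            = appLK
frameStep-sameKind (esRedex _ _ _ _ _) = esBK

Similar : Ctx → Ctx → Set
Similar = Pointwise SameKind

similar-swap : ∀ P {f f'} F → SameKind f f' → Similar (P ++ f ∷ F) (P ++ f' ∷ F)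
similar-swap P F k = ++⁺ (Pointwise.refl sameKind-refl) (k ∷ Pointwise.refl sameKind-refl)

similar-shape : ∀ {E E'} → Similar E E' → shape E ≡ shape E'
similar-shape sim = Pointwise.Pointwise-≡⇒≡ (Pointwise.map⁺ dirF dirF (Pointwise.map sameKind-dir sim))

similar-nb : ∀ {E E'} → Similar E E' → nb E ≡ nb E'
similar-nb []           = refl
similar-nb (lamK ∷ sim)  = cong suc (similar-nb sim)
similar-nb (appLK ∷ sim) = similar-nb sim
similar-nb (appRK ∷ sim) = similar-nb sim
similar-nb (esBK ∷ sim)  = cong suc (similar-nb sim)
similar-nb (esSK ∷ sim)  = similar-nb sim

similar-shallow : ∀ {E E'} → Similar E E' → Shallow E → Shallow E'
similar-shallow = All-resp-Pointwise sameKind-shallowF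

similar-substCtx : ∀ L {Z} → Similar Z (map esBF L) → Σ (List Tm) λ L₀ → Z ≡ map esBF L₀
similar-substCtx []      []           = [] , refl
similar-substCtx (_ ∷ L) (esBK ∷ sim) with similar-substCtx L sim
... | L₀ , refl = _ ∷ L₀ , refl

similar-applicativeCtx : ∀ A {t L E} → Similar E (A ++ appLF t ∷ map esBF L) → Applicative E
similar-applicativeCtx [] {L = L} (appLK ∷ sim) with similar-substCtx L sim
... | L₀ , refl = [] , _ , L₀ , refl
similar-applicativeCtx (_ ∷ A) (_ ∷ sim) with similar-applicativeCtx A sim
... | A₀ , t₀ , L₀ , refl = _ ∷ A₀ , t₀ , L₀ , refl

similar-applicative : ∀ {E E'} → Similar E E' → Applicative E' → Applicative E
similar-applicative sim (A , _ , _ , refl) = similar-applicativeCtx A sim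

uselessAt-transfer : ∀ {E E' r r'} → Similar E E' → (βNormal (relUnf E r) → relUnf E' r' ≡ relUnf E r) →
  UselessAt E r → UselessAt E' r'
uselessAt-transfer {E} {E'} {r} {r'} sim eq (shallow , notUseful) = similar-shallow sim shallow , notUseful′
  where
  sameUnf : relUnf E' r' ≡ relUnf E r
  sameUnf = eq (λ h → notUseful (inj₁ h))
  notUseful′ : ¬ UsefulCond E' r'
  notUseful′ (inj₁ β) = notUseful (inj₁ (subst HasBeta sameUnf β))
  notUseful′ (inj₂ (abs , applicative)) =
    notUseful (inj₂ (subst IsAbs sameUnf abs , similar-applicative sim applicative))

uselessAt-frameStep : ∀ P F {f f' r} → FrameStep f f' → UselessAt (P ++ f ∷ F) r → UselessAt (P ++ f' ∷ F) r
uselessAt-frameStep P F rw =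
  uselessAt-transfer (similar-swap P F (frameStep-sameKind rw)) (relUnf-frameStep P F rw)

uselessAt-esRedex-lsTerm : ∀ P F G {L s w} X →
  UselessAt (P ++ esBF (plug G (dBRedex L s w)) ∷ F) (lsTerm F (plug G (dBRedex L s w))) →
  UselessAt (P ++ esBF (plug G X) ∷ F) (lsTerm F (plug G X))
uselessAt-esRedex-lsTerm P F G X = uselessAt-transfer (similar-swap P F esBK) (relUnf-esRedex-lsTerm P F G X)

frameStepOf : ∀ {t} (Q : Redex t) → Useful Q → ∀ P {f g} F G x → Divergent f g →
  pos Q ≡ P ++ g ∷ G → t ≡ plug P (plugF f (plug F x)) →
  Σ Frame λ f' → FrameStep f f' × target Q ≡ plug (P ++ f' ∷ F) x
frameStepOf Q _ P F G x divApp posQ source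
  with plug-injective P (trans (sym source) (source-at Q {X = _ ∷ G} posQ))
... | refl = _ , appArg , trans (target-at Q {X = _ ∷ G} posQ) (sym (plug-++ P (appLF _ ∷ F) x))
frameStepOf Q@(dB C L s w e) _ P F G x divES posQ source
  with plug-injective P (trans (sym source) (source-at Q {X = _ ∷ G} posQ))
... | refl = _ , esRedex G L s w _ , trans (target-at Q {X = _ ∷ G} posQ) (sym (plug-++ P (esBF _ ∷ F) x))
frameStepOf (ls D C u e) (shallowQ , _) P F G x divES posQ _ =
  ⊥-elim (shallow-∌esSF P (subst Shallow posQ shallowQ))

data Splits {A : Set} : List A → A → List A → List A → A → List A → Set where
  same  : ∀ {P x F} → Splits P x F P x F
  left  : ∀ {P x y C} D₂ → Splits P x (D₂ ++ y ∷ C) (P ++ x ∷ D₂) y C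
  right : ∀ {D y x F} C₁ → Splits (D ++ y ∷ C₁) x F D y (C₁ ++ x ∷ F)

compareSplits : ∀ {A : Set} P (x : A) F D y C → P ++ x ∷ F ≡ D ++ y ∷ C → Splits P x F D y C
compareSplits []      x F []      y C refl = same
compareSplits []      x F (_ ∷ D) y C refl = left D
compareSplits (_ ∷ P) x F []      y C refl = right P
compareSplits (p ∷ P) x F (d ∷ D) y C e with ∷-injective e
... | refl , e' with compareSplits P x F D y C e'
... | same     = same
... | left D₂  = left D₂
... | right C₁ = right C₁

UselessLsRedexAt : Tm → Ctx → Set
UselessLsRedexAt T E = Σ (Redex T) λ R' → pos R' ≡ E × kind R' ≡ kls × Useless R'

lsRedexAt : ∀ {T} E D C u {n} → E ≡ D ++ esBF u ∷ C → n ≡ nb C → T ≡ plug E (var n) →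
  UselessAt E (sh 0 (suc n) u) → UselessLsRedexAt T E
lsRedexAt E D C u refl refl eT useless = ls D C u (trans eT (plug-++ D (esBF u ∷ C) _)) , refl , refl , useless

residualRedex-here : ∀ {T} P F {u f'} → FrameStep (esBF u) f' → T ≡ plug (P ++ f' ∷ F) (var (nb F)) →
  UselessAt (P ++ esBF u ∷ F) (lsTerm F u) → UselessLsRedexAt T (P ++ f' ∷ F)
residualRedex-here P F (esRedex G L s w X) eT useless =
  lsRedexAt _ P F (plug G X) refl refl eT (uselessAt-esRedex-lsTerm P F G X useless)

residualRedex : ∀ {T} P {f f'} F D u C → FrameStep f f' → P ++ f ∷ F ≡ D ++ esBF u ∷ C →
  T ≡ plug (P ++ f' ∷ F) (var (nb C)) → UselessAt (P ++ f ∷ F) (lsTerm C u) →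
  UselessLsRedexAt T (P ++ f' ∷ F)
residualRedex P F D u C rw e eT useless with compareSplits P _ F D _ C e
... | same     = residualRedex-here P F rw eT useless
... | left D₂  = lsRedexAt _ (P ++ _ ∷ D₂) C u (sym (++-assoc P (_ ∷ D₂) (esBF u ∷ C))) refl eT
                   (uselessAt-frameStep P F rw useless)
... | right C₁ = lsRedexAt _ D (C₁ ++ _ ∷ F) u (++-assoc D (esBF u ∷ C₁) (_ ∷ F))
                   (similar-nb (similar-swap C₁ F (frameStep-sameKind rw))) eT (uselessAt-frameStep P F rw useless)

mainTheorem13 : ∀ {t} (R Q : Redex t) → Useless R → Useful Q → pos R ≺LO pos Q →
    Σ (Redex (target Q)) λ R' →
      Residual Q R R' × (∀ R'' → Residual Q R R'' → pos R'' ≡ pos R') ×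
      ShallowRedex R' × Useless R'
mainTheorem13 (dB _ _ _ _ _) Q () _ _
mainTheorem13 (ls D C u e) Q _ _ (inj₁ R≺Q) = ⊥-elim (ls-¬≺O D C u e Q R≺Q)
mainTheorem13 R@(ls D C u e) Q useless useful (inj₂ R≺Q) with ≺L-divergence R≺Q
... | P , f , g , F , G , div , posR , posQ
  with frameStepOf Q useful P F G (var (nb C)) div posQ (source-at R {X = f ∷ F} posR)
... | f' , rw , eT
  with residualRedex P F D u C rw (sym posR) eT (subst (λ E → UselessAt E (lsTerm C u)) posR useless)
... | R' , posR' , kindR' , useless' =
  R' , disjoint-residual Q R R' disjoint kindR' sameShape ,
  disjoint-residual-unique Q R R' disjoint (proj₁ useless) sameShape ,
  useless-shallow R' useless' , useless'
  where
  disjoint = divergent-¬prefix P F G div posR posQ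
  sameShape : shape (pos R') ≡ shape (pos R)
  sameShape = trans (cong shape posR')
    (trans (sym (similar-shape (similar-swap P F (frameStep-sameKind rw)))) (cong shape (sym posR)))
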